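{- For $a, b \in \mathbb{R}$ and $n \geq 0$, $$c_n(a, b) = \frac{1}{n+1} \sum_{j=0}^{\lfloor n/2 \rfloor} \binom{2n-j}{n} \binom{n-j}{j} a^{n-2j} b^j.$$
   Context: For real parameters $a, b$, the sequence $c_n(a,b)$ is defined by $c_0(a,b) = 1$ and, for $n \geq 1$, the recurrence $$c_n(a,b) = a \sum_{\substack{u_1, u_2 \geq 0 \\ u_1 + u_2 = n-1}} c_{u_1}(a,b)\, c_{u_2}(a,b) \;+\; b \sum_{\substack{u_1, u_2, u_3 \geq 0 \\ u_1 + u_2 + u_3 = n-2}} c_{u_1}(a,b)\, c_{u_2}(a,b)\, c_{u_3}(a,b)$$ (the second sum being empty when $n = 1$). Equivalently, the generating function $C_{a,b}(z) = \sum_{n \geq 0} c_n(a,b) z^n$ satisfies $C_{a,b}(z) = 1 + a z C_{a,b}(z)^2 + b z^2 C_{a,b}(z)^3$, and $D_{a,b}(z) := z C_{a,b}(z)$ is the composition inverse near $0$ of $P_{a,b}(w) = w - a w^2 - b w^3$. -}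

module Defs where

open import Level using (Level)
open import Data.Nat using (ℕ; zero; suc; _∸_; _≤ᵇ_)
import Data.Nat as ℕ
open import Data.Nat.DivMod using (_/_)
open import Data.Nat.Combinatorics using (_C_)
open import Data.Bool using (if_then_else_)
open import Algebra.Bundles using (CommutativeRing)

module Seq {c ℓ : Level} (R : CommutativeRing c ℓ) where
  open CommutativeRing R hiding (zero)

  fromℕ : ℕ → Carrier
  fromℕ zero    = 0#
  fromℕ (suc k) = 1# + fromℕ k

  pow : Carrier → ℕ → Carrier
  pow x zero    = 1#
  pow x (suc k) = x * pow x k

  sumUpTo : (ℕ → Carrier) → ℕ → Carrier
  sumUpTo f zero    = f zero
  sumUpTo f (suc m) = sumUpTo f m + f (suc m)

  conv2 : (ℕ → Carrier) → ℕ → Carrier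
  conv2 f m = sumUpTo (λ u → f u * f (m ∸ u)) m

  conv3 : (ℕ → Carrier) → ℕ → Carrier
  conv3 f m = sumUpTo (λ u₁ → sumUpTo (λ u₂ → f u₁ * f u₂ * f (m ∸ u₁ ∸ u₂)) (m ∸ u₁)) m

  -- conv3 over u1+u2+u3 = n-2 for n = suc m, empty when n = 1
  conv3' : (ℕ → Carrier) → ℕ → Carrier
  conv3' f zero    = 0#
  conv3' f (suc k) = conv3 f k

  module _ (a b : Carrier) where
    step : (ℕ → Carrier) → ℕ → Carrier
    step f zero    = 1#
    step f (suc m) = a * conv2 f m + b * conv3' f m

    -- table k i = c_i(a,b) for all i ≤ k
    table : ℕ → ℕ → Carrier
    table zero    i = 1#
    table (suc k) i = if i ≤ᵇ k then table k i else step (table k) (suc k)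

  cseq : Carrier → Carrier → ℕ → Carrier
  cseq a b n = table a b n n

  rhsSum : Carrier → Carrier → ℕ → Carrier
  rhsSum a b n =
    sumUpTo (λ j → fromℕ (((2 ℕ.* n ∸ j) C n) ℕ.* ((n ∸ j) C j))
                   * (pow a (n ∸ 2 ℕ.* j) * pow b j))
            (n / 2)

-- D = z C(z) is the compositional inverse of P(w) = w (1 − a w − b w²), so by Lagrange–Bürmann
-- [zⁿ] C(z)^r = [wⁿ] P′(w) φ(w)^(n+r+1) with φ = (1 − a w − b w²)⁻¹, a polynomial in a and b.
-- Over an arbitrary commutative ring this family is taken as the definition: Pascal-type
-- recurrences for the coefficients of φ^e show that it satisfies C^(r+1) = C^r (1 + a z C² + b z² C³)
-- and C⁰ = 1, hence C^r C^s = C^(r+s), so its member r = 1 obeys the recurrence defining c_n.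
-- Euler's identity w (φ^e)′ = e (a w + 2 b w²) φ^(e+1) then gives (n + 1) [wⁿ] P′ φ^(n+2) = [wⁿ] φ^(n+1),
-- whose binomial expansion is the stated sum.

module Submission where

open import Defs
open import Level using (Level)
open import Data.Nat using (ℕ; suc)
open import Algebra.Bundles using (CommutativeRing)

module Combinatorics where

  open import Data.Nat using (ℕ; zero; suc; _+_; _*_; _<_; _≤ᵇ_)
  open import Data.Bool using (false)
  open import Data.Nat.Properties
  open import Data.Nat.DivMod using (_/_; _%_; m≡m%n+[m/n]*n; m%n<n)
  open import Data.Nat.Combinatorics using (_C_; nCn≡1; k>n⇒nCk≡0; nCk+nC[k+1]≡[n+1]C[k+1]; nC1≡n)
  open import Data.Nat.Tactic.RingSolver using (solve-∀)
  open import Relation.Binary.PropositionalEquality using (_≡_; refl; sym; trans; cong; cong₂)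
  open ≤-Reasoning

  [1+k]*[1+n]C[1+k]≡[1+n]*nCk : ∀ n k → suc k * (suc n C suc k) ≡ suc n * (n C k)
  [1+k]*[1+n]C[1+k]≡[1+n]*nCk zero    zero    = refl
  [1+k]*[1+n]C[1+k]≡[1+n]*nCk zero    (suc k) = *-zeroʳ (suc (suc k))
  [1+k]*[1+n]C[1+k]≡[1+n]*nCk (suc n) zero    = trans (+-identityʳ _) (trans (nC1≡n (suc (suc n))) (sym (*-identityʳ _)))
  [1+k]*[1+n]C[1+k]≡[1+n]*nCk (suc n) (suc k) = begin-equality
    suc (suc k) * (suc (suc n) C suc (suc k))
      ≡⟨ cong (suc (suc k) *_) (sym (nCk+nC[k+1]≡[n+1]C[k+1] (suc n) (suc k))) ⟩
    suc (suc k) * (suc n C suc k + suc n C suc (suc k))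
      ≡⟨ expand (suc k) (suc n C suc k) (suc n C suc (suc k)) ⟩
    suc k * (suc n C suc k) + suc n C suc k + suc (suc k) * (suc n C suc (suc k))
      ≡⟨ cong₂ (λ x y → x + suc n C suc k + y) ([1+k]*[1+n]C[1+k]≡[1+n]*nCk n k) ([1+k]*[1+n]C[1+k]≡[1+n]*nCk n (suc k)) ⟩
    suc n * (n C k) + suc n C suc k + suc n * (n C suc k)
      ≡⟨ collect (suc n) (n C k) (suc n C suc k) (n C suc k) ⟩
    suc n * (n C k + n C suc k) + suc n C suc k
      ≡⟨ cong (λ x → suc n * x + suc n C suc k) (nCk+nC[k+1]≡[n+1]C[k+1] n k) ⟩
    suc n * (suc n C suc k) + suc n C suc k
      ≡⟨ +-comm (suc n * (suc n C suc k)) _ ⟩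
    suc (suc n) * (suc n C suc k) ∎
    where
    expand : ∀ k x y → suc k * (x + y) ≡ k * x + x + suc k * y
    expand = solve-∀
    collect : ∀ m x y z → m * x + y + m * z ≡ m * (x + z) + y
    collect = solve-∀

  -- multichoose e p = C(e + p − 1, p) = [xᵖ] (1 − x)^(−e)
  multichoose : ℕ → ℕ → ℕ
  multichoose zero    zero    = 1
  multichoose zero    (suc p) = 0
  multichoose (suc e) p       = (e + p) C e

  multichoose-0 : ∀ e → multichoose e 0 ≡ 1
  multichoose-0 zero    = refl
  multichoose-0 (suc e) = trans (cong (_C e) (+-identityʳ e)) (nCn≡1 e)

  multichoose-pascal : ∀ e p → multichoose (suc e) (suc p) ≡ multichoose e (suc p) + multichoose (suc e) p
  multichoose-pascal zero    p = refl
  multichoose-pascal (suc e) p = begin-equality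
    suc (e + suc p) C suc e                   ≡⟨ nCk+nC[k+1]≡[n+1]C[k+1] (e + suc p) e ⟨
    (e + suc p) C e + (e + suc p) C suc e     ≡⟨ cong (λ n → (e + suc p) C e + n C suc e) (+-suc e p) ⟩
    (e + suc p) C e + (suc e + p) C suc e     ∎

  multichoose-absorb : ∀ e p → suc p * multichoose e (suc p) ≡ e * multichoose (suc e) p
  multichoose-absorb zero    p = *-zeroʳ (suc p)
  multichoose-absorb (suc e) p = begin-equality
    suc p * X              ≡⟨ +-cancelˡ-≡ (suc e * X) _ _ split ⟨
    suc e * Y              ≡⟨ cong (λ n → suc e * (n C suc e)) (+-suc e p) ⟩
    suc e * ((suc e + p) C suc e) ∎
    where
    X = (e + suc p) C e
    Y = (e + suc p) C suc e
    split : suc e * X + suc e * Y ≡ suc e * X + suc p * X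
    split = begin-equality
      suc e * X + suc e * Y                 ≡⟨ *-distribˡ-+ (suc e) X Y ⟨
      suc e * (X + Y)                       ≡⟨ cong (suc e *_) (nCk+nC[k+1]≡[n+1]C[k+1] (e + suc p) e) ⟩
      suc e * (suc (e + suc p) C suc e)     ≡⟨ [1+k]*[1+n]C[1+k]≡[1+n]*nCk (e + suc p) e ⟩
      (suc e + suc p) * X                   ≡⟨ *-distribʳ-+ X (suc e) (suc p) ⟩
      suc e * X + suc p * X                 ∎

  -- c p j is the coefficient of a^(p−j) b^j w^(p+j): a word of p letters, j of which are b.
  -- shiftA and shiftB multiply the series by a w and by b w².
  Coeffs : Set
  Coeffs = ℕ → ℕ → ℕ

  shiftA : Coeffs → Coeffs
  shiftA c zero    j = 0
  shiftA c (suc p) j = c p j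

  shiftB : Coeffs → Coeffs
  shiftB c zero    j       = 0
  shiftB c (suc p) zero    = 0
  shiftB c (suc p) (suc j) = c p j

  Vanishing : Coeffs → Set
  Vanishing c = ∀ p j → p < j → c p j ≡ 0

  -- (1 − a w − b w²)^(−e) = Σₚ multichoose e p (a w + b w²)ᵖ
  invPowCoeff : ℕ → Coeffs
  invPowCoeff e p j = multichoose e p * (p C j)

  invPowCoeff-vanishing : ∀ e → Vanishing (invPowCoeff e)
  invPowCoeff-vanishing e p j p<j = trans (cong (multichoose e p *_) (k>n⇒nCk≡0 p<j)) (*-zeroʳ (multichoose e p))

  invPowCoeff-pascal : ∀ e p j → let c = invPowCoeff (suc e) in
    invPowCoeff (suc e) p j ≡ invPowCoeff e p j + shiftA c p j + shiftB c p j
  invPowCoeff-pascal e zero j = begin-equality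
    multichoose (suc e) 0 * (0 C j)             ≡⟨ cong (_* (0 C j)) (trans (multichoose-0 (suc e)) (sym (multichoose-0 e))) ⟩
    multichoose e 0 * (0 C j)                   ≡⟨ trans (+-identityʳ _) (+-identityʳ _) ⟨
    multichoose e 0 * (0 C j) + 0 + 0           ∎
  invPowCoeff-pascal e (suc p) zero = begin-equality
    multichoose (suc e) (suc p) * 1                          ≡⟨ *-identityʳ _ ⟩
    multichoose (suc e) (suc p)                              ≡⟨ multichoose-pascal e p ⟩
    multichoose e (suc p) + multichoose (suc e) p            ≡⟨ ones (multichoose e (suc p)) (multichoose (suc e) p) ⟩
    multichoose e (suc p) * 1 + multichoose (suc e) p * 1 + 0 ∎
    where
    ones : ∀ x y → x + y ≡ x * 1 + y * 1 + 0
    ones = solve-∀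
  invPowCoeff-pascal e (suc p) (suc j) = begin-equality
    multichoose (suc e) (suc p) * (suc p C suc j)
      ≡⟨ cong₂ _*_ (multichoose-pascal e p) (sym (nCk+nC[k+1]≡[n+1]C[k+1] p j)) ⟩
    (multichoose e (suc p) + multichoose (suc e) p) * (p C j + p C suc j)
      ≡⟨ expand (multichoose e (suc p)) (multichoose (suc e) p) (p C j) (p C suc j) ⟩
    multichoose e (suc p) * (p C j + p C suc j) + multichoose (suc e) p * (p C suc j) + multichoose (suc e) p * (p C j)
      ≡⟨ cong (λ n → multichoose e (suc p) * n + multichoose (suc e) p * (p C suc j) + multichoose (suc e) p * (p C j))
              (nCk+nC[k+1]≡[n+1]C[k+1] p j) ⟩
    multichoose e (suc p) * (suc p C suc j) + multichoose (suc e) p * (p C suc j) + multichoose (suc e) p * (p C j) ∎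
    where
    expand : ∀ x y u v → (x + y) * (u + v) ≡ x * (u + v) + y * v + y * u
    expand = solve-∀

  binomial-euler : ∀ q j → (suc q + suc j) * (suc q C suc j) ≡ suc q * (q C suc j + 2 * (q C j))
  binomial-euler q j = begin-equality
    (suc q + suc j) * B                                ≡⟨ *-distribʳ-+ B (suc q) (suc j) ⟩
    suc q * B + suc j * B                              ≡⟨ cong₂ (λ x y → suc q * x + y) (sym (nCk+nC[k+1]≡[n+1]C[k+1] q j))
                                                                ([1+k]*[1+n]C[1+k]≡[1+n]*nCk q j) ⟩
    suc q * (q C j + q C suc j) + suc q * (q C j)      ≡⟨ collect (suc q) (q C j) (q C suc j) ⟩
    suc q * (q C suc j + 2 * (q C j))                  ∎
    where
    B = suc q C suc j
    collect : ∀ m x y → m * (x + y) + m * x ≡ m * (y + 2 * x)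
    collect = solve-∀

  invPowCoeff-euler : ∀ e p j → let c = invPowCoeff (suc e) in
    (p + j) * invPowCoeff e p j ≡ e * (shiftA c p j + 2 * shiftB c p j)
  invPowCoeff-euler e zero    zero    = sym (*-zeroʳ e)
  invPowCoeff-euler e zero    (suc j) =
    trans (cong (suc j *_) (*-zeroʳ (multichoose e 0))) (trans (*-zeroʳ (suc j)) (sym (*-zeroʳ e)))
  invPowCoeff-euler e (suc q) zero    = begin-equality
    (suc q + 0) * (multichoose e (suc q) * 1)   ≡⟨ cong₂ _*_ (+-identityʳ (suc q)) (*-identityʳ _) ⟩
    suc q * multichoose e (suc q)               ≡⟨ multichoose-absorb e q ⟩
    e * multichoose (suc e) q                   ≡⟨ cong (e *_) (trans (+-identityʳ _) (*-identityʳ _)) ⟨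
    e * (multichoose (suc e) q * 1 + 0)         ∎
  invPowCoeff-euler e (suc q) (suc j) = begin-equality
    (suc q + suc j) * (M * (suc q C suc j))                 ≡⟨ x*[y*z]≡y*[x*z] (suc q + suc j) M (suc q C suc j) ⟩
    M * ((suc q + suc j) * (suc q C suc j))                 ≡⟨ cong (M *_) (binomial-euler q j) ⟩
    M * (suc q * T)                                         ≡⟨ x*[y*z]≡y*[x*z] M (suc q) T ⟩
    suc q * (M * T)                                         ≡⟨ *-assoc (suc q) M T ⟨
    suc q * M * T                                           ≡⟨ cong (_* T) (multichoose-absorb e q) ⟩
    e * M′ * T                                              ≡⟨ distribute e M′ (q C suc j) (q C j) ⟩
    e * (M′ * (q C suc j) + 2 * (M′ * (q C j)))             ∎
    where
    M = multichoose e (suc q)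
    M′ = multichoose (suc e) q
    T = q C suc j + 2 * (q C j)
    x*[y*z]≡y*[x*z] : ∀ x y z → x * (y * z) ≡ y * (x * z)
    x*[y*z]≡y*[x*z] = solve-∀
    distribute : ∀ e m u v → e * m * (u + 2 * v) ≡ e * (m * u + 2 * (m * v))
    distribute = solve-∀

  -- Euler's identity in degree e + 1, where the factor e + 1 can be cancelled (in ℕ, not in a general ring).
  invPowCoeff-residue : ∀ e p j → p + j ≡ suc e → let c = invPowCoeff (suc (suc e)) in
    invPowCoeff (suc e) p j ≡ shiftA c p j + 2 * shiftB c p j
  invPowCoeff-residue e p j p+j≡1+e =
    *-cancelˡ-≡ _ _ (suc e) (trans (cong (_* invPowCoeff (suc e) p j) (sym p+j≡1+e)) (invPowCoeff-euler (suc e) p j))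

  n/2<j⇒n<j+j : ∀ n j → n / 2 < j → n < j + j
  n/2<j⇒n<j+j n j n/2<j = begin-strict
    n                    ≡⟨ m≡m%n+[m/n]*n n 2 ⟩
    n % 2 + n / 2 * 2    <⟨ +-monoˡ-< (n / 2 * 2) (m%n<n n 2) ⟩
    suc (n / 2) * 2      ≤⟨ *-monoˡ-≤ 2 n/2<j ⟩
    j * 2                ≡⟨ *-comm j 2 ⟩
    j + (j + 0)          ≡⟨ cong (j +_) (+-identityʳ j) ⟩
    j + j                ∎

  1+n≰ᵇn : ∀ n → (suc n ≤ᵇ n) ≡ false
  1+n≰ᵇn zero    = refl
  1+n≰ᵇn (suc n) = 1+n≰ᵇn n

open Combinatorics

module Series {r ℓ : Level} (R : CommutativeRing r ℓ) where

  open import Data.Nat as ℕ using (zero; _∸_; _≤_; _<_; _≤′_; z≤n; s≤s)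
  open import Data.Nat.Properties
    using ( ≤-refl; ≤-trans; <-trans; <⇒≤; <⇒≤pred; ≰⇒>; _≤?_; n<1+n; m≤n⇒m≤1+n; m≤n⇒m<n∨m≡n
          ; ≤⇒≤′; ≤′⇒≤; ≤⇒≤ᵇ; +-suc; n∸n≡0; m∸n≤m; m∸n+n≡m; +-∸-assoc; ∸-+-assoc; m<n+o⇒m∸n<o )
  import Data.Nat.Properties as ℕₚ
  open import Data.Nat.DivMod using (_/_; m/n≤m)
  open import Data.Nat.Combinatorics using (_C_; k>n⇒nCk≡0)
  open import Data.Nat.Induction using (<-rec)
  open import Data.Bool.Properties using (T-≡)
  open import Data.Maybe using (nothing)
  open import Data.Sum using (inj₁; inj₂)
  open import Function.Bundles using (Equivalence)
  open import Relation.Nullary using (yes; no)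
  open import Relation.Binary.PropositionalEquality as ≡ using (_≡_)
  import Tactic.RingSolver.Core.AlmostCommutativeRing as ACR
  import Tactic.RingSolver.NonReflective as NonReflective

  open CommutativeRing R hiding (zero)
  open Seq R
  open import Algebra.Properties.Semiring.Mult semiring using (_×_; ×-homo-+; ×1-homo-*)
  open import Algebra.Properties.CommutativeSemigroup +-commutativeSemigroup using (interchange)
  open import Algebra.Properties.CommutativeSemigroup *-commutativeSemigroup using (x∙yz≈y∙xz)
  open import Algebra.Properties.AbelianGroup +-abelianGroup using (⁻¹-∙-comm; xyx⁻¹≈y)
  open import Algebra.Properties.Ring ring using (x[y-z]≈xy-xz; -0#≈0#)
  open NonReflective (ACR.fromCommutativeRing R (λ _ → nothing)) using (solve; _⊜_; _⊕_; _⊗_)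
  open import Relation.Binary.Reasoning.Setoid setoid

  fromℕ≡×1# : ∀ n → fromℕ n ≡ n × 1#
  fromℕ≡×1# zero    = ≡.refl
  fromℕ≡×1# (suc n) = ≡.cong (1# +_) (fromℕ≡×1# n)

  fromℕ-+ : ∀ m n → fromℕ (m ℕ.+ n) ≈ fromℕ m + fromℕ n
  fromℕ-+ m n rewrite fromℕ≡×1# (m ℕ.+ n) | fromℕ≡×1# m | fromℕ≡×1# n = ×-homo-+ 1# m n

  fromℕ-* : ∀ m n → fromℕ (m ℕ.* n) ≈ fromℕ m * fromℕ n
  fromℕ-* m n rewrite fromℕ≡×1# (m ℕ.* n) | fromℕ≡×1# m | fromℕ≡×1# n = ×1-homo-* m n

  sumUpTo-cong : ∀ {f g} m → (∀ j → j ≤ m → f j ≈ g j) → sumUpTo f m ≈ sumUpTo g m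
  sumUpTo-cong zero    f≈g = f≈g 0 z≤n
  sumUpTo-cong (suc m) f≈g =
    +-cong (sumUpTo-cong m (λ j j≤m → f≈g j (m≤n⇒m≤1+n j≤m))) (f≈g (suc m) ≤-refl)

  sumUpTo-+ : ∀ f g m → sumUpTo (λ j → f j + g j) m ≈ sumUpTo f m + sumUpTo g m
  sumUpTo-+ f g zero    = refl
  sumUpTo-+ f g (suc m) = trans (+-congʳ (sumUpTo-+ f g m)) (interchange _ _ _ _)

  *-distribˡ-sumUpTo : ∀ x f m → x * sumUpTo f m ≈ sumUpTo (λ j → x * f j) m
  *-distribˡ-sumUpTo x f zero    = refl
  *-distribˡ-sumUpTo x f (suc m) = trans (distribˡ x _ _) (+-congʳ (*-distribˡ-sumUpTo x f m))

  sumUpTo-unfoldˡ : ∀ f m → sumUpTo f (suc m) ≈ f 0 + sumUpTo (λ j → f (suc j)) m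
  sumUpTo-unfoldˡ f zero    = refl
  sumUpTo-unfoldˡ f (suc m) = trans (+-congʳ (sumUpTo-unfoldˡ f m)) (+-assoc _ _ _)

  sumUpTo-extend : ∀ f {m n} → (∀ j → m < j → f j ≈ 0#) → m ≤ n → sumUpTo f m ≈ sumUpTo f n
  sumUpTo-extend f {m} vanish m≤n = go (≤⇒≤′ m≤n)
    where
    go : ∀ {n} → m ≤′ n → sumUpTo f m ≈ sumUpTo f n
    go ℕ.≤′-refl              = refl
    go (ℕ.≤′-step {n} m≤′n) = begin
      sumUpTo f m              ≈⟨ go m≤′n ⟩
      sumUpTo f n              ≈⟨ +-identityʳ _ ⟨
      sumUpTo f n + 0#         ≈⟨ +-congˡ (vanish (suc n) (s≤s (≤′⇒≤ m≤′n))) ⟨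
      sumUpTo f (suc n)        ∎

  δ : ℕ → Carrier
  δ zero    = 1#
  δ (suc _) = 0#

  shift : (ℕ → Carrier) → ℕ → Carrier
  shift f zero    = 0#
  shift f (suc n) = f n

  shift-cong : ∀ {f g} n → (∀ k → k < n → f k ≈ g k) → shift f n ≈ shift g n
  shift-cong zero    f≈g = refl
  shift-cong (suc n) f≈g = f≈g n (n<1+n n)

  shift-pointwise : (F : Carrier → Carrier → Carrier → Carrier) → F 0# 0# 0# ≈ 0# →
    ∀ {f g h k} → (∀ n → f n ≈ F (g n) (h n) (k n)) → ∀ n → shift f n ≈ F (shift g n) (shift h n) (shift k n)
  shift-pointwise F F000≈0 f≈F zero    = sym F000≈0
  shift-pointwise F F000≈0 f≈F (suc n) = f≈F n

  conv : (ℕ → Carrier) → (ℕ → Carrier) → ℕ → Carrier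
  conv f g m = sumUpTo (λ u → f u * g (m ∸ u)) m

  conv-cong : ∀ {f f′ g g′} m → (∀ u → u ≤ m → f u ≈ f′ u) → (∀ u → u ≤ m → g u ≈ g′ u) →
    conv f g m ≈ conv f′ g′ m
  conv-cong m f≈f′ g≈g′ = sumUpTo-cong m (λ u u≤m → *-cong (f≈f′ u u≤m) (g≈g′ (m ∸ u) (m∸n≤m m u)))

  conv-congˡ : ∀ {f f′} g m → (∀ u → u ≤ m → f u ≈ f′ u) → conv f g m ≈ conv f′ g m
  conv-congˡ g m f≈f′ = conv-cong {g = g} m f≈f′ (λ _ _ → refl)

  conv-+ˡ : ∀ f g h m → conv (λ u → f u + g u) h m ≈ conv f h m + conv g h m
  conv-+ˡ f g h m = trans (sumUpTo-cong m (λ u _ → distribʳ _ _ _)) (sumUpTo-+ _ _ m)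

  conv-*ˡ : ∀ x f h m → conv (λ u → x * f u) h m ≈ x * conv f h m
  conv-*ˡ x f h m = trans (sumUpTo-cong m (λ u _ → *-assoc _ _ _)) (sym (*-distribˡ-sumUpTo x _ m))

  conv-shiftˡ : ∀ f g m → conv (shift f) g m ≈ shift (conv f g) m
  conv-shiftˡ f g zero    = zeroˡ _
  conv-shiftˡ f g (suc m) = begin
    conv (shift f) g (suc m)                     ≈⟨ sumUpTo-unfoldˡ _ m ⟩
    0# * g (suc m) + conv f g m                  ≈⟨ +-congʳ (zeroˡ _) ⟩
    0# + conv f g m                              ≈⟨ +-identityˡ _ ⟩
    conv f g m                                   ∎

  conv-δˡ : ∀ g m → conv δ g m ≈ g m
  conv-δˡ g m = begin
    conv δ g m          ≈⟨ sumUpTo-extend (λ u → δ u * g (m ∸ u)) (λ { (suc u) _ → zeroˡ _ }) (z≤n {m}) ⟨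
    1# * g m            ≈⟨ *-identityˡ _ ⟩
    g m                 ∎

  conv3≈conv-conv : ∀ f m → conv3 f m ≈ conv f (conv f f) m
  conv3≈conv-conv f m = sumUpTo-cong m (λ u _ →
    trans (sumUpTo-cong (m ∸ u) (λ v _ → *-assoc _ _ _)) (sym (*-distribˡ-sumUpTo (f u) _ (m ∸ u))))

  -‿lincomb : ∀ a b x y z u v w → (x + a * y + b * z) - (u + a * v + b * w) ≈ (x - u) + a * (y - v) + b * (z - w)
  -‿lincomb a b x y z u v w = begin
    (x + a * y + b * z) - (u + a * v + b * w)       ≈⟨ -‿+-distrib (x + a * y) (b * z) (u + a * v) (b * w) ⟨
    (x + a * y) - (u + a * v) + (b * z - b * w)     ≈⟨ +-congʳ (-‿+-distrib x (a * y) u (a * v)) ⟨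
    (x - u) + (a * y - a * v) + (b * z - b * w)     ≈⟨ +-cong (+-congˡ (x[y-z]≈xy-xz a y v)) (x[y-z]≈xy-xz b z w) ⟨
    (x - u) + a * (y - v) + b * (z - w)             ∎
    where
    -‿+-distrib : ∀ p q r s → (p - r) + (q - s) ≈ (p + q) - (r + s)
    -‿+-distrib p q r s = trans (interchange p (- r) q (- s)) (+-congˡ (⁻¹-∙-comm r s))

  module _ (a b : Carrier) where

    monomial : ℕ → ℕ → Carrier
    monomial p j = pow a (p ∸ j) * pow b j

    -- the coefficient of wᵐ in the series encoded by c
    eval : Coeffs → ℕ → Carrier
    eval c m = sumUpTo (λ j → fromℕ (c (m ∸ j) j) * monomial (m ∸ j) j) m

    eval-cong : ∀ c d m → (∀ j → j ≤ m → c (m ∸ j) j ≡ d (m ∸ j) j) → eval c m ≈ eval d m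
    eval-cong c d m c≡d = sumUpTo-cong m (λ j j≤m → *-congʳ (reflexive (≡.cong fromℕ (c≡d j j≤m))))

    eval-+ : ∀ c d m → eval (λ p j → c p j ℕ.+ d p j) m ≈ eval c m + eval d m
    eval-+ c d m =
      trans (sumUpTo-cong m (λ j _ → trans (*-congʳ (fromℕ-+ (c (m ∸ j) j) (d (m ∸ j) j))) (distribʳ _ _ _)))
            (sumUpTo-+ _ _ m)

    eval-scale : ∀ k c m → eval (λ p j → k ℕ.* c p j) m ≈ fromℕ k * eval c m
    eval-scale k c m =
      trans (sumUpTo-cong m (λ j _ → trans (*-congʳ (fromℕ-* k (c (m ∸ j) j))) (*-assoc _ _ _)))
            (sym (*-distribˡ-sumUpTo _ _ m))

    eval-degree : ∀ c m → fromℕ m * eval c m ≈ eval (λ p j → (p ℕ.+ j) ℕ.* c p j) m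
    eval-degree c m = trans (*-distribˡ-sumUpTo _ _ m) (sumUpTo-cong m (λ j j≤m → begin
      fromℕ m * (fromℕ (c (m ∸ j) j) * monomial (m ∸ j) j)         ≈⟨ *-assoc _ _ _ ⟨
      fromℕ m * fromℕ (c (m ∸ j) j) * monomial (m ∸ j) j           ≈⟨ *-congʳ (fromℕ-* m _) ⟨
      fromℕ (m ℕ.* c (m ∸ j) j) * monomial (m ∸ j) j               ≡⟨ ≡.cong (λ k → fromℕ (k ℕ.* c (m ∸ j) j) * monomial (m ∸ j) j)
                                                                            (≡.sym (m∸n+n≡m j≤m)) ⟩
      fromℕ ((m ∸ j ℕ.+ j) ℕ.* c (m ∸ j) j) * monomial (m ∸ j) j   ∎))

    eval-shiftA : ∀ {c} → Vanishing c → ∀ n → a * shift (eval c) n ≈ eval (shiftA c) n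
    eval-shiftA {c} vanish zero    = trans (zeroʳ a) (sym (zeroˡ _))
    eval-shiftA {c} vanish (suc m) = begin
      a * eval c m                                         ≈⟨ *-distribˡ-sumUpTo a _ m ⟩
      sumUpTo (λ j → a * (fromℕ (c (m ∸ j) j) * monomial (m ∸ j) j)) m
                                                           ≈⟨ sumUpTo-cong m shiftTerm ⟩
      sumUpTo T m                                          ≈⟨ +-identityʳ _ ⟨
      sumUpTo T m + 0#                                     ≈⟨ +-congˡ lastTerm ⟨
      eval (shiftA c) (suc m)                              ∎
      where
      T : ℕ → Carrier
      T j = fromℕ (shiftA c (suc m ∸ j) j) * monomial (suc m ∸ j) j
      lastTerm : T (suc m) ≈ 0#
      lastTerm rewrite n∸n≡0 m = zeroˡ _
      a*term : ∀ p j → a * (fromℕ (c p j) * monomial p j) ≈ fromℕ (c p j) * monomial (suc p) j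
      a*term p j with j ≤? p
      ... | yes j≤p rewrite +-∸-assoc 1 j≤p = trans (x∙yz≈y∙xz a _ _) (*-congˡ (sym (*-assoc a _ _)))
      ... | no  j≰p rewrite vanish p j (≰⇒> j≰p) = trans (*-congˡ (zeroˡ _)) (trans (zeroʳ a) (sym (zeroˡ _)))
      shiftTerm : ∀ j → j ≤ m → a * (fromℕ (c (m ∸ j) j) * monomial (m ∸ j) j) ≈ T j
      shiftTerm j j≤m rewrite +-∸-assoc 1 j≤m = a*term (m ∸ j) j

    eval-shiftB : ∀ c n → b * shift (shift (eval c)) n ≈ eval (shiftB c) n
    eval-shiftB c zero          = trans (zeroʳ b) (sym (zeroˡ _))
    eval-shiftB c (suc zero)    = trans (zeroʳ b) (sym (trans (+-cong (zeroˡ _) (zeroˡ _)) (+-identityʳ 0#)))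
    eval-shiftB c (suc (suc m)) = begin
      b * eval c m                                         ≈⟨ *-distribˡ-sumUpTo b _ m ⟩
      sumUpTo (λ j → b * (fromℕ (c (m ∸ j) j) * monomial (m ∸ j) j)) m
                                                           ≈⟨ sumUpTo-cong m shiftTerm ⟩
      sumUpTo (λ j → T (suc j)) m                          ≈⟨ +-identityʳ _ ⟨
      sumUpTo (λ j → T (suc j)) m + 0#                     ≈⟨ +-congˡ lastTerm ⟨
      sumUpTo (λ j → T (suc j)) (suc m)                    ≈⟨ +-identityˡ _ ⟨
      0# + sumUpTo (λ j → T (suc j)) (suc m)               ≈⟨ +-congʳ (zeroˡ _) ⟨
      T 0 + sumUpTo (λ j → T (suc j)) (suc m)              ≈⟨ sumUpTo-unfoldˡ T (suc m) ⟨
      eval (shiftB c) (suc (suc m))                        ∎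
      where
      T : ℕ → Carrier
      T j = fromℕ (shiftB c (suc (suc m) ∸ j) j) * monomial (suc (suc m) ∸ j) j
      lastTerm : T (suc (suc m)) ≈ 0#
      lastTerm rewrite n∸n≡0 m = zeroˡ _
      shiftTerm : ∀ j → j ≤ m → b * (fromℕ (c (m ∸ j) j) * monomial (m ∸ j) j) ≈ T (suc j)
      shiftTerm j j≤m rewrite +-∸-assoc 1 j≤m = trans (x∙yz≈y∙xz b _ _) (*-congˡ (x∙yz≈y∙xz b _ _))

    -- multiplication by a w + 2 b w² = −w (1 − a w − b w²)′
    dDenom : (ℕ → Carrier) → ℕ → Carrier
    dDenom f n = a * shift f n + fromℕ 2 * (b * shift (shift f) n)

    lincomb-0 : ∀ x → x + a * 0# + b * 0# ≈ x
    lincomb-0 x = trans (+-cong (+-congˡ (zeroʳ a)) (zeroʳ b)) (trans (+-identityʳ _) (+-identityʳ x))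

    dDenom-0 : ∀ f → dDenom f 0 ≈ 0#
    dDenom-0 f = trans (+-cong (zeroʳ a) (trans (*-congˡ (zeroʳ b)) (zeroʳ (fromℕ 2)))) (+-identityʳ 0#)

    eval-dDenom : ∀ {c} → Vanishing c → ∀ n → eval (λ p j → shiftA c p j ℕ.+ 2 ℕ.* shiftB c p j) n ≈ dDenom (eval c) n
    eval-dDenom {c} vanish n = begin
      eval (λ p j → shiftA c p j ℕ.+ 2 ℕ.* shiftB c p j) n  ≈⟨ eval-+ (shiftA c) (λ p j → 2 ℕ.* shiftB c p j) n ⟩
      eval (shiftA c) n + eval (λ p j → 2 ℕ.* shiftB c p j) n
                                                            ≈⟨ +-congˡ (eval-scale 2 (shiftB c) n) ⟩
      eval (shiftA c) n + fromℕ 2 * eval (shiftB c) n       ≈⟨ +-cong (eval-shiftA vanish n) (*-congˡ (eval-shiftB c n)) ⟨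
      dDenom (eval c) n                                      ∎

    invPow : ℕ → ℕ → Carrier
    invPow e = eval (invPowCoeff e)

    invPow-pascal : ∀ e n → let f = invPow (suc e) in f n ≈ invPow e n + a * shift f n + b * shift (shift f) n
    invPow-pascal e n = begin
      invPow (suc e) n                                     ≈⟨ eval-cong (invPowCoeff (suc e)) summands n
                                                                     (λ j _ → invPowCoeff-pascal e (n ∸ j) j) ⟩
      eval summands n                                      ≈⟨ eval-+ (λ p j → invPowCoeff e p j ℕ.+ shiftA c p j) (shiftB c) n ⟩
      eval (λ p j → invPowCoeff e p j ℕ.+ shiftA c p j) n + eval (shiftB c) n
                                                           ≈⟨ +-congʳ (eval-+ (invPowCoeff e) (shiftA c) n) ⟩
      invPow e n + eval (shiftA c) n + eval (shiftB c) n   ≈⟨ +-cong (+-congˡ (eval-shiftA (invPowCoeff-vanishing (suc e)) n))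
                                                                     (eval-shiftB c n) ⟨
      invPow e n + a * shift (invPow (suc e)) n + b * shift (shift (invPow (suc e))) n ∎
      where
      c = invPowCoeff (suc e)
      summands : Coeffs
      summands p j = invPowCoeff e p j ℕ.+ shiftA c p j ℕ.+ shiftB c p j

    invPow-euler : ∀ e n → fromℕ n * invPow e n ≈ fromℕ e * dDenom (invPow (suc e)) n
    invPow-euler e n = begin
      fromℕ n * invPow e n                                 ≈⟨ eval-degree (invPowCoeff e) n ⟩
      eval (λ p j → (p ℕ.+ j) ℕ.* invPowCoeff e p j) n     ≈⟨ eval-cong (λ p j → (p ℕ.+ j) ℕ.* invPowCoeff e p j) (λ p j → e ℕ.* d p j) n
                                                                     (λ j _ → invPowCoeff-euler e (n ∸ j) j) ⟩
      eval (λ p j → e ℕ.* d p j) n                         ≈⟨ eval-scale e d n ⟩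
      fromℕ e * eval d n                                   ≈⟨ *-congˡ (eval-dDenom (invPowCoeff-vanishing (suc e)) n) ⟩
      fromℕ e * dDenom (invPow (suc e)) n                  ∎
      where
      c = invPowCoeff (suc e)
      d : Coeffs
      d p j = shiftA c p j ℕ.+ 2 ℕ.* shiftB c p j

    invPow-residue : ∀ e → invPow (suc e) (suc e) ≈ dDenom (invPow (suc (suc e))) (suc e)
    invPow-residue e =
      trans (eval-cong (invPowCoeff (suc e)) (λ p j → shiftA c p j ℕ.+ 2 ℕ.* shiftB c p j) (suc e)
                       (λ j j≤1+e → invPowCoeff-residue e (suc e ∸ j) j (m∸n+n≡m j≤1+e)))
            (eval-dDenom (invPowCoeff-vanishing (suc (suc e))) (suc e))
      where c = invPowCoeff (suc (suc e))

    shift-pascalForm : ∀ {f g h k} → (∀ n → f n ≈ g n + a * h n + b * k n) →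
      ∀ n → shift f n ≈ shift g n + a * shift h n + b * shift k n
    shift-pascalForm = shift-pointwise (λ x y z → x + a * y + b * z) (lincomb-0 0#)

    shift-lagrangeForm : ∀ {f g h} → (∀ n → f n ≈ g n - dDenom h n) → ∀ n → shift f n ≈ shift g n - dDenom (shift h) n
    shift-lagrangeForm {h = h} =
      shift-pointwise (λ x y z → x - (a * y + fromℕ 2 * (b * z))) (trans (+-congˡ (-‿cong (dDenom-0 h))) (-‿inverseʳ 0#))

    -- lagrangeCoeff e n = [wⁿ] P′(w) (1 − a w − b w²)^(−e−1), where P′(w) = 1 − 2 a w − 3 b w²
    lagrangeCoeff : ℕ → ℕ → Carrier
    lagrangeCoeff e n = invPow e n - dDenom (invPow (suc e)) n

    lagrangeCoeff-pascal : ∀ e n → let f = lagrangeCoeff (suc e) in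
      f n ≈ lagrangeCoeff e n + a * shift f n + b * shift (shift f) n
    lagrangeCoeff-pascal e n = begin
      invPow (suc e) n - (a * y₁ + two * (b * y₂))
        ≈⟨ +-cong (invPow-pascal e n) (-‿cong (+-cong (*-congˡ y₁≈) (*-congˡ (*-congˡ y₂≈)))) ⟩
      (x₀ + a * x₁ + b * x₂) - (a * (x₁ + a * y₂ + b * y₃) + two * (b * (x₂ + a * y₃ + b * y₄)))
        ≈⟨ +-congˡ (-‿cong (regroup a b two x₁ x₂ y₂ y₃ y₄)) ⟩
      (x₀ + a * x₁ + b * x₂) - ((a * x₁ + two * (b * x₂)) + a * (a * y₂ + two * (b * y₃)) + b * (a * y₃ + two * (b * y₄)))
        ≈⟨ -‿lincomb a b _ _ _ _ _ _ ⟩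
      (x₀ - (a * x₁ + two * (b * x₂))) + a * (x₁ - (a * y₂ + two * (b * y₃))) + b * (x₂ - (a * y₃ + two * (b * y₄)))
        ≈⟨ +-cong (+-congˡ (*-congˡ shift₁)) (*-congˡ shift₂) ⟨
      lagrangeCoeff e n + a * shift (lagrangeCoeff (suc e)) n + b * shift (shift (lagrangeCoeff (suc e))) n ∎
      where
      two = fromℕ 2
      Γ₁ = invPow (suc e)
      Γ₂ = invPow (suc (suc e))
      x₀ = invPow e n
      x₁ = shift Γ₁ n
      x₂ = shift (shift Γ₁) n
      y₁ = shift Γ₂ n
      y₂ = shift (shift Γ₂) n
      y₃ = shift (shift (shift Γ₂)) n
      y₄ = shift (shift (shift (shift Γ₂))) n

      y₁≈ : y₁ ≈ x₁ + a * y₂ + b * y₃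
      y₁≈ = shift-pascalForm (invPow-pascal (suc e)) n
      y₂≈ : y₂ ≈ x₂ + a * y₃ + b * y₄
      y₂≈ = shift-pascalForm (shift-pascalForm (invPow-pascal (suc e))) n
      shift₁ : shift (lagrangeCoeff (suc e)) n ≈ x₁ - (a * y₂ + two * (b * y₃))
      shift₁ = shift-lagrangeForm (λ _ → refl) n
      shift₂ : shift (shift (lagrangeCoeff (suc e))) n ≈ x₂ - (a * y₃ + two * (b * y₄))
      shift₂ = shift-lagrangeForm (shift-lagrangeForm (λ _ → refl)) n

      regroup : ∀ a b t x₁ x₂ y₂ y₃ y₄ →
        a * (x₁ + a * y₂ + b * y₃) + t * (b * (x₂ + a * y₃ + b * y₄))
        ≈ (a * x₁ + t * (b * x₂)) + a * (a * y₂ + t * (b * y₃)) + b * (a * y₃ + t * (b * y₄))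
      regroup = solve 8 (λ a b t x₁ x₂ y₂ y₃ y₄ →
        (a ⊗ (x₁ ⊕ a ⊗ y₂ ⊕ b ⊗ y₃) ⊕ t ⊗ (b ⊗ (x₂ ⊕ a ⊗ y₃ ⊕ b ⊗ y₄)))
        ⊜ ((a ⊗ x₁ ⊕ t ⊗ (b ⊗ x₂)) ⊕ a ⊗ (a ⊗ y₂ ⊕ t ⊗ (b ⊗ y₃)) ⊕ b ⊗ (a ⊗ y₃ ⊕ t ⊗ (b ⊗ y₄)))) refl

    lagrangeCoeff-diagonal : ∀ n → lagrangeCoeff n n ≈ δ n
    lagrangeCoeff-diagonal zero    = begin
      (1# + 0#) * (1# * 1#) - dDenom (invPow 1) 0         ≈⟨ +-cong (trans (*-cong (+-identityʳ 1#) (*-identityˡ 1#)) (*-identityˡ 1#))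
                                                                    (-‿cong (dDenom-0 (invPow 1))) ⟩
      1# - 0#                                              ≈⟨ +-congˡ -0#≈0# ⟩
      1# + 0#                                              ≈⟨ +-identityʳ 1# ⟩
      1#                                                   ∎
    lagrangeCoeff-diagonal (suc n) = trans (+-congʳ (invPow-residue n)) (-‿inverseʳ _)

    -- [zⁿ] C(z)^r, by Lagrange–Bürmann
    cPow : ℕ → ℕ → Carrier
    cPow r n = lagrangeCoeff (r ℕ.+ n) n

    shift-cPow : ∀ r n → shift (cPow (suc r)) n ≡ shift (lagrangeCoeff (r ℕ.+ n)) n
    shift-cPow r zero    = ≡.refl
    shift-cPow r (suc m) = ≡.cong (λ e → lagrangeCoeff e m) (≡.sym (+-suc r m))

    shift²-cPow : ∀ r n → shift (shift (cPow (suc (suc r)))) n ≡ shift (shift (lagrangeCoeff (r ℕ.+ n))) n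
    shift²-cPow r zero    = ≡.refl
    shift²-cPow r (suc m) = ≡.trans (shift-cPow (suc r) m) (≡.cong (λ e → shift (lagrangeCoeff e) m) (≡.sym (+-suc r m)))

    cPow-pascal : ∀ r n → cPow (suc r) n ≈ cPow r n + a * shift (cPow (2 ℕ.+ r)) n + b * shift (shift (cPow (3 ℕ.+ r))) n
    cPow-pascal r n = trans (lagrangeCoeff-pascal (r ℕ.+ n) n)
      (reflexive (≡.cong₂ (λ x y → cPow r n + a * x + b * y) (≡.sym (shift-cPow (suc r) n)) (≡.sym (shift²-cPow (suc r) n))))

    cPow-conv : ∀ m r s → conv (cPow r) (cPow s) m ≈ cPow (r ℕ.+ s) m
    cPow-conv = <-rec _ go
      where
      go : ∀ m → (∀ {k} → k < m → ∀ r s → conv (cPow r) (cPow s) k ≈ cPow (r ℕ.+ s) k) →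
           ∀ r s → conv (cPow r) (cPow s) m ≈ cPow (r ℕ.+ s) m
      go m ih zero    s = trans (conv-congˡ (cPow s) m (λ u _ → lagrangeCoeff-diagonal u)) (conv-δˡ (cPow s) m)
      go m ih (suc r) s = begin
        conv (cPow (suc r)) (cPow s) m
          ≈⟨ conv-congˡ (cPow s) m (λ u _ → cPow-pascal r u) ⟩
        conv (λ u → cPow r u + a * F u + b * shift G u) (cPow s) m
          ≈⟨ trans (conv-+ˡ (λ u → cPow r u + a * F u) (λ u → b * shift G u) (cPow s) m)
                   (+-congʳ (conv-+ˡ (cPow r) (λ u → a * F u) (cPow s) m)) ⟩
        conv (cPow r) (cPow s) m + conv (λ u → a * F u) (cPow s) m + conv (λ u → b * shift G u) (cPow s) m
          ≈⟨ +-cong (+-congˡ (trans (conv-*ˡ a F (cPow s) m) (*-congˡ (conv-shiftˡ (cPow (2 ℕ.+ r)) (cPow s) m))))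
                    (trans (conv-*ˡ b (shift G) (cPow s) m)
                           (*-congˡ (trans (conv-shiftˡ G (cPow s) m)
                                           (shift-cong m (λ k _ → conv-shiftˡ (cPow (3 ℕ.+ r)) (cPow s) k))))) ⟩
        conv (cPow r) (cPow s) m + a * shift (conv (cPow (2 ℕ.+ r)) (cPow s)) m
          + b * shift (shift (conv (cPow (3 ℕ.+ r)) (cPow s))) m
          ≈⟨ +-cong (+-cong (go m ih r s) (*-congˡ (shift-cong m (λ k k<m → ih k<m (2 ℕ.+ r) s))))
                    (*-congˡ (shift-cong m (λ k k<m → shift-cong k (λ i i<k → ih (<-trans i<k k<m) (3 ℕ.+ r) s)))) ⟩
        cPow (r ℕ.+ s) m + a * shift (cPow (2 ℕ.+ r ℕ.+ s)) m + b * shift (shift (cPow (3 ℕ.+ r ℕ.+ s))) m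
          ≈⟨ cPow-pascal (r ℕ.+ s) m ⟨
        cPow (suc r ℕ.+ s) m ∎
        where
        F = shift (cPow (2 ℕ.+ r))
        G = shift (cPow (3 ℕ.+ r))

    table-stable : ∀ k i → i ≤ k → table a b k i ≡ cseq a b i
    table-stable zero    zero    z≤n = ≡.refl
    table-stable (suc k) i       i≤1+k with m≤n⇒m<n∨m≡n i≤1+k
    ... | inj₁ (s≤s i≤k) rewrite Equivalence.to T-≡ (≤⇒≤ᵇ i≤k) = table-stable k i i≤k
    ... | inj₂ ≡.refl  = ≡.refl

    step-conv : ∀ f m → step a b f (suc m) ≈ a * conv f f m + b * shift (conv f (conv f f)) m
    step-conv f zero    = refl
    step-conv f (suc k) = +-congˡ (*-congˡ (conv3≈conv-conv f k))

    step-cong : ∀ {f g} n → (∀ u → u < n → f u ≈ g u) → step a b f n ≈ step a b g n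
    step-cong         zero    f≈g = refl
    step-cong {f} {g} (suc m) f≈g = begin
      step a b f (suc m)                                   ≈⟨ step-conv f m ⟩
      a * conv f f m + b * shift (conv f (conv f f)) m     ≈⟨ +-cong (*-congˡ (conv-cong m (below ≤-refl) (below ≤-refl)))
                                                                     (*-congˡ (shift-cong m triple)) ⟩
      a * conv g g m + b * shift (conv g (conv g g)) m     ≈⟨ step-conv g m ⟨
      step a b g (suc m)                                   ∎
      where
      below : ∀ {k} → k ≤ m → ∀ u → u ≤ k → f u ≈ g u
      below k≤m u u≤k = f≈g u (s≤s (≤-trans u≤k k≤m))
      triple : ∀ k → k < m → conv f (conv f f) k ≈ conv g (conv g g) k
      triple k k<m = conv-cong k (below (<⇒≤ k<m)) (λ v v≤k → conv-cong v (below (≤-trans v≤k (<⇒≤ k<m))) (below (≤-trans v≤k (<⇒≤ k<m))))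

    step-unique : ∀ {f g} → (∀ n → f n ≈ step a b f n) → (∀ n → g n ≈ step a b g n) → ∀ n → f n ≈ g n
    step-unique f-step g-step = <-rec _ λ n ih → trans (f-step n) (trans (step-cong n (λ u u<n → ih u<n)) (sym (g-step n)))

    cseq-step : ∀ n → cseq a b n ≈ step a b (cseq a b) n
    cseq-step zero    = refl
    cseq-step (suc m) rewrite 1+n≰ᵇn m = step-cong (suc m) (λ u u<1+m → reflexive (table-stable m u (<⇒≤pred u<1+m)))

    cPow₁-step : ∀ n → cPow 1 n ≈ step a b (cPow 1) n
    cPow₁-step zero    = trans (cPow-pascal 0 0) (trans (lincomb-0 _) (lagrangeCoeff-diagonal 0))
    cPow₁-step (suc m) = begin
      cPow 1 (suc m)                                        ≈⟨ cPow-pascal 0 (suc m) ⟩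
      cPow 0 (suc m) + a * cPow 2 m + b * shift (cPow 3) m  ≈⟨ +-congʳ (+-congʳ (lagrangeCoeff-diagonal (suc m))) ⟩
      0# + a * cPow 2 m + b * shift (cPow 3) m              ≈⟨ +-congʳ (+-identityˡ _) ⟩
      a * cPow 2 m + b * shift (cPow 3) m                   ≈⟨ +-cong (*-congˡ (cPow-conv m 1 1)) (*-congˡ (shift-cong m cPow₃≈)) ⟨
      a * conv (cPow 1) (cPow 1) m + b * shift (conv (cPow 1) (conv (cPow 1) (cPow 1))) m
                                                            ≈⟨ step-conv (cPow 1) m ⟨
      step a b (cPow 1) (suc m)                             ∎
      where
      cPow₃≈ : ∀ k → k < m → conv (cPow 1) (conv (cPow 1) (cPow 1)) k ≈ cPow 3 k
      cPow₃≈ k _ = trans (conv-cong k (λ _ _ → refl) (λ v _ → cPow-conv v 1 1)) (cPow-conv k 1 2)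

    [1+n]*cPow₁≈invPow : ∀ n → fromℕ (suc n) * cPow 1 n ≈ invPow (suc n) n
    [1+n]*cPow₁≈invPow n = begin
      fromℕ (suc n) * (G - D)                    ≈⟨ x[y-z]≈xy-xz (fromℕ (suc n)) G D ⟩
      fromℕ (suc n) * G - fromℕ (suc n) * D      ≈⟨ +-congˡ (-‿cong (invPow-euler (suc n) n)) ⟨
      fromℕ (suc n) * G - fromℕ n * G            ≈⟨ +-congʳ (trans (distribʳ G 1# (fromℕ n)) (trans (+-congʳ (*-identityˡ G)) (+-comm G _))) ⟩
      fromℕ n * G + G - fromℕ n * G              ≈⟨ xyx⁻¹≈y (fromℕ n * G) G ⟩
      G                                          ∎
      where
      G = invPow (suc n) n
      D = dDenom (invPow (suc (suc n))) n

    rhsSum≈invPow : ∀ n → rhsSum a b n ≈ invPow (suc n) n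
    rhsSum≈invPow n = begin
      sumUpTo F (n / 2)    ≈⟨ sumUpTo-extend F vanish (m/n≤m n 2) ⟩
      sumUpTo F n          ≈⟨ sumUpTo-cong n (λ j j≤n → reflexive (summand j j≤n)) ⟩
      invPow (suc n) n     ∎
      where
      F : ℕ → Carrier
      F j = fromℕ (((2 ℕ.* n ∸ j) C n) ℕ.* ((n ∸ j) C j)) * (pow a (n ∸ 2 ℕ.* j) * pow b j)
      vanish : ∀ j → n / 2 < j → F j ≈ 0#
      vanish (suc j) n/2<1+j rewrite k>n⇒nCk≡0 (m<n+o⇒m∸n<o n (suc j) (n/2<j⇒n<j+j n (suc j) n/2<1+j))
                                   | ℕₚ.*-zeroʳ ((2 ℕ.* n ∸ suc j) C n) = zeroˡ _
      summand : ∀ j → j ≤ n → F j ≡ fromℕ (invPowCoeff (suc n) (n ∸ j) j) * monomial (n ∸ j) j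
      summand j j≤n = ≡.cong₂ (λ x y → fromℕ ((x C n) ℕ.* ((n ∸ j) C j)) * (pow a y * pow b j))
        (≡.trans (≡.cong (λ k → n ℕ.+ k ∸ j) (ℕₚ.+-identityʳ n)) (+-∸-assoc n j≤n))
        (≡.trans (≡.cong (λ k → n ∸ (j ℕ.+ k)) (ℕₚ.+-identityʳ j)) (≡.sym (∸-+-assoc n j j)))

proposition6p1 : {c ℓ : Level} (R : CommutativeRing c ℓ) →
    (a b : CommutativeRing.Carrier R) (n : ℕ) →
    (inv : CommutativeRing.Carrier R) →
    CommutativeRing._≈_ R (CommutativeRing._*_ R inv (Seq.fromℕ R (suc n))) (CommutativeRing.1# R) →
    CommutativeRing._≈_ R (Seq.cseq R a b n) (CommutativeRing._*_ R inv (Seq.rhsSum R a b n))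
proposition6p1 R a b n inv inv*[1+n]≈1 = begin
  cseq a b n                                  ≈⟨ step-unique a b (cseq-step a b) (cPow₁-step a b) n ⟩
  cPow a b 1 n                                ≈⟨ *-identityˡ _ ⟨
  1# * cPow a b 1 n                           ≈⟨ *-congʳ inv*[1+n]≈1 ⟨
  inv * fromℕ (suc n) * cPow a b 1 n          ≈⟨ *-assoc inv _ _ ⟩
  inv * (fromℕ (suc n) * cPow a b 1 n)        ≈⟨ *-congˡ ([1+n]*cPow₁≈invPow a b n) ⟩
  inv * invPow a b (suc n) n                  ≈⟨ *-congˡ (rhsSum≈invPow a b n) ⟨
  inv * rhsSum a b n                          ∎
  where
  open CommutativeRing R
  open Seq R
  open Series R
  open import Relation.Binary.Reasoning.Setoid setoid
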